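{- The $(6^3)$ lattice (the hexagonal lattice) and the $(4,8^2)$ lattice (the graph of the truncated square tiling by squares and regular octagons) are $(5,1)$-total-threshold-colorable.
   Context: An edge labeling of a graph $G=(V,E)$ is a map $l:E\to\{N,F\}$ (near/far). A threshold-coloring of $G$ with respect to $l$ is a map $c:V\to\mathbb{Z}$ for which there is an integer $t\ge 0$ such that for every edge $(u,v)$, $|c(u)-c(v)|\le t$ iff $l(u,v)=N$; if $m,M$ are the minimum and maximum of $c$, any integer $r>M-m$ is a range, and $c$ is an $(r,t)$-threshold-coloring. $G$ is $(r,t)$-total-threshold-colorable if for every edge labeling there is an $(r,t)$-threshold-coloring with respect to it. An Archimedean lattice is the infinite graph of vertices and edges of an edge-to-edge tiling of the plane by regular polygons in which every vertex has the same species (the cyclic sequence of numbers of sides of the polygons around it); it is named by its species, e.g. $(6^3)$ = each vertex in three hexagons, $(4,8^2)$ = each vertex in one square and two octagons. By convention, any induced subgraph of such a lattice is also referred to as the lattice, so the claim applies to all induced subgraphs. -}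

module Defs where

open import Data.Bool using (Bool; true; false; T)
open import Data.Nat using (ℕ)
open import Data.Integer using (ℤ; _+_; _-_; ∣_∣; +_; _≤_)
open import Data.Product using (_×_; _,_; Σ; ∃)
open import Relation.Binary.PropositionalEquality using (_≡_)

-- Graphs: a vertex type and a type of (undirected) edges, each edge
-- listed exactly once, with its two endpoints.

record Graph : Set₁ where
  field
    V   : Set
    E   : Set
    src : E → V
    tgt : E → V
open Graph public

data Label : Set where
  N F : Label

-- Induced subgraph of G on the vertex set S (a Bool-valued predicate on vertices,
-- so membership proofs T (S v) are unique):
-- an edge of G belongs to it iff both endpoints are in S.

EdgeLabeling : (G : Graph) → (V G → Bool) → Set
EdgeLabeling G S = (e : E G) → T (S (src G e)) → T (S (tgt G e)) → Label

Coloring : (G : Graph) → (V G → Bool) → Set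
Coloring G S = (v : V G) → T (S v) → ℤ

-- c is an (r,t)-threshold-coloring of G[S] w.r.t. l:
--  * all colors lie in a window [m, m + r - 1] of r consecutive integers
--    (equivalently, r > max c - min c), and
--  * for every edge (u,v):  |c u - c v| ≤ t  iff  l(u,v) = N.
IsThresholdColoring : (G : Graph) (S : V G → Bool) (r t : ℕ) →
                      EdgeLabeling G S → Coloring G S → Set
IsThresholdColoring G S r t l c =
  (∃ λ (m : ℤ) → (v : V G) (s : T (S v)) →
      (m ≤ c v s) × (c v s + + 1 ≤ m + + r))
  × ((e : E G) (su : T (S (src G e))) (sv : T (S (tgt G e))) →
      ((∣ c (src G e) su - c (tgt G e) sv ∣ Data.Nat.≤ t → l e su sv ≡ N)
       × (l e su sv ≡ N → ∣ c (src G e) su - c (tgt G e) sv ∣ Data.Nat.≤ t)))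
  where import Data.Nat

TotalThresholdColorable : (G : Graph) → (V G → Bool) → ℕ → ℕ → Set
TotalThresholdColorable G S r t =
  (l : EdgeLabeling G S) → Σ (Coloring G S) (IsThresholdColoring G S r t l)

-- The (6^3) lattice (honeycomb).  Vertices: two sublattices
-- A(x,y) = (x,y,true), B(x,y) = (x,y,false).  Each A(x,y) is adjacent to
-- B(x,y), B(x-1,y), B(x,y-1).

data HexEdge : Set where
  e₀ e₁ e₂ : ℤ → ℤ → HexEdge

hexSrc : HexEdge → ℤ × ℤ × Bool
hexSrc (e₀ x y) = x , y , true
hexSrc (e₁ x y) = x , y , true
hexSrc (e₂ x y) = x , y , true

hexTgt : HexEdge → ℤ × ℤ × Bool
hexTgt (e₀ x y) = x , y , false
hexTgt (e₁ x y) = x - + 1 , y , false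
hexTgt (e₂ x y) = x , y - + 1 , false

Hexagonal : Graph
Hexagonal = record { V = ℤ × ℤ × Bool ; E = HexEdge ; src = hexSrc ; tgt = hexTgt }

-- The (4,8^2) lattice (truncated square tiling): every point (x,y) of the
-- square lattice is replaced by a square with corners east/north/west/south;
-- (x,y,east) is joined to (x+1,y,west) and (x,y,north) to (x,y+1,south).
-- The faces are these squares and octagons (one per face of Z^2).

data Dir : Set where
  east north west south : Dir

nextDir : Dir → Dir
nextDir east  = north
nextDir north = west
nextDir west  = south
nextDir south = east

data OctEdge : Set where
  sq : ℤ → ℤ → Dir → OctEdge
  hl : ℤ → ℤ → OctEdge
  vl : ℤ → ℤ → OctEdge

octSrc : OctEdge → ℤ × ℤ × Dir
octSrc (sq x y d) = x , y , d
octSrc (hl x y)   = x , y , east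
octSrc (vl x y)   = x , y , north

octTgt : OctEdge → ℤ × ℤ × Dir
octTgt (sq x y d) = x , y , nextDir d
octTgt (hl x y)   = x + + 1 , y , west
octTgt (vl x y)   = x , y + + 1 , south

TruncatedSquare : Graph
TruncatedSquare = record { V = ℤ × ℤ × Dir ; E = OctEdge ; src = octSrc ; tgt = octTgt }

module Submission where

-- With colours 0,…,4 and threshold 1, colour 2 is near exactly 1 and 3, and two colours
-- of {0,1,3,4} are near iff they lie on the same side of 2.  So it suffices to choose a set
-- of hubs (coloured 2) such that no two hubs are adjacent, every other vertex has at most
-- one hub neighbour, and the remaining vertices form disjoint bi-infinite paths.  Along a
-- path the side of 2 is forced by the labels (flip exactly at far edges), which a prefix
-- xor-sum realises; whether a vertex takes the inner colour (1 or 3) or the outer one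
-- (0 or 4) is read off the label of its hub edge.  In (4,8²) the hubs are the east corners
-- and the paths run up the columns of squares; in (6³) the hubs form a pattern of density
-- 1/4 with period 4 in the rows, and each path snakes through a pair of adjacent rows.
-- An induced subgraph is handled by extending its labelling to the whole lattice.

open import Defs
open import Data.Bool using (Bool; true; false; T; not; _xor_)
open import Data.Bool.Properties
  using (xor-assoc; xor-comm; xor-same; xor-identityʳ; xor-annihilates-not;
         not-distribˡ-xor; not-distribʳ-xor)
open import Data.Empty using (⊥-elim)
open import Data.Fin using (Fin; toℕ; #_)
open import Data.Fin.Properties using (toℕ<n)
open import Data.Integer using (ℤ; +_; -[1+_]; _+_; _-_; -_; ∣_∣)
import Data.Integer as ℤ
open import Data.Integer.Properties using (+-assoc; +-identityʳ; ∣i-j∣≡∣j-i∣)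
open import Data.Nat as ℕ using (zero; suc)
import Data.Nat.Properties as ℕ
open import Data.Product using (_×_; _,_)
open import Data.Unit using (tt)
open import Function using (_∘_)
open import Relation.Binary.PropositionalEquality
open import Relation.Nullary.Decidable using (⌊_⌋; toWitness; fromWitness)

xor-cancelˡ : ∀ x y → x xor (x xor y) ≡ y
xor-cancelˡ x y = trans (sym (xor-assoc x x y)) (cong (_xor y) (xor-same x))

xor-cancelʳ : ∀ x y → (x xor y) xor y ≡ x
xor-cancelʳ x y = trans (xor-assoc x y y) (trans (cong (x xor_) (xor-same y)) (xor-identityʳ x))

xor-shift : ∀ p o f → (p xor o) xor (p xor (o xor f)) ≡ f
xor-shift false o f = xor-cancelˡ o f
xor-shift true  o f = trans (xor-annihilates-not o (o xor f)) (xor-cancelˡ o f)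

i-1+1≡i : ∀ i → i - + 1 + + 1 ≡ i
i-1+1≡i i = trans (+-assoc i (- + 1) (+ 1)) (+-identityʳ i)

i+1-1≡i : ∀ i → i + + 1 - + 1 ≡ i
i+1-1≡i i = trans (+-assoc i (+ 1) (- + 1)) (+-identityʳ i)

isFar : Label → Bool
isFar N = false
isFar F = true

isNear : Label → Bool
isNear l = not (isFar l)

data Role : Set where
  hub  : Role
  leaf : (side inner : Bool) → Role

colour : Role → Fin 5
colour hub                = # 2
colour (leaf false false) = # 0
colour (leaf false true)  = # 1
colour (leaf true  true)  = # 3
colour (leaf true  false) = # 4

⟦_⟧ : Role → ℤ
⟦ a ⟧ = + toℕ (colour a)

data Compatible : Role → Role → Label → Set where
  hub-leaf  : ∀ {s i l} → i ≡ isNear l → Compatible hub (leaf s i) l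
  leaf-hub  : ∀ {s i l} → i ≡ isNear l → Compatible (leaf s i) hub l
  leaf-leaf : ∀ {s s′ i i′ l} → s xor s′ ≡ isFar l → Compatible (leaf s i) (leaf s′ i′) l

compatible-sym : ∀ {a b l} → Compatible a b l → Compatible b a l
compatible-sym (hub-leaf eq)  = leaf-hub eq
compatible-sym (leaf-hub eq)  = hub-leaf eq
compatible-sym (leaf-leaf {s} {s′} eq) = leaf-leaf (trans (xor-comm s′ s) eq)

path-start : ∀ p {p′ i i′ l} → p′ ≡ p xor isFar l → Compatible (leaf p i) (leaf p′ i′) l
path-start p refl = leaf-leaf (xor-cancelˡ p _)

path-step : ∀ p o {p′ i i′ l} → p′ ≡ p xor (o xor isFar l) →
            Compatible (leaf (p xor o) i) (leaf p′ i′) l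
path-step p o refl = leaf-leaf (xor-shift p o _)

near : ℤ → ℤ → Bool
near a b = ⌊ ∣ a - b ∣ ℕ.≤? 1 ⌋

near-sym : ∀ a b → near a b ≡ near b a
near-sym a b = cong (λ n → ⌊ n ℕ.≤? 1 ⌋) (∣i-j∣≡∣j-i∣ a b)

near-leaf-hub : ∀ s i → near ⟦ leaf s i ⟧ ⟦ hub ⟧ ≡ i
near-leaf-hub false false = refl
near-leaf-hub false true  = refl
near-leaf-hub true  false = refl
near-leaf-hub true  true  = refl

near-leaf-leaf : ∀ s i s′ i′ → near ⟦ leaf s i ⟧ ⟦ leaf s′ i′ ⟧ ≡ not (s xor s′)
near-leaf-leaf false false false false = refl
near-leaf-leaf false false false true  = refl
near-leaf-leaf false false true  false = refl
near-leaf-leaf false false true  true  = refl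
near-leaf-leaf false true  false false = refl
near-leaf-leaf false true  false true  = refl
near-leaf-leaf false true  true  false = refl
near-leaf-leaf false true  true  true  = refl
near-leaf-leaf true  false false false = refl
near-leaf-leaf true  false false true  = refl
near-leaf-leaf true  false true  false = refl
near-leaf-leaf true  false true  true  = refl
near-leaf-leaf true  true  false false = refl
near-leaf-leaf true  true  false true  = refl
near-leaf-leaf true  true  true  false = refl
near-leaf-leaf true  true  true  true  = refl

compatible⇒near : ∀ {a b l} → Compatible a b l → near ⟦ a ⟧ ⟦ b ⟧ ≡ isNear l
compatible⇒near (hub-leaf {s} {i} eq) =
  trans (near-sym ⟦ hub ⟧ ⟦ leaf s i ⟧) (trans (near-leaf-hub s i) eq)
compatible⇒near (leaf-hub {s} {i} eq) = trans (near-leaf-hub s i) eq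
compatible⇒near (leaf-leaf {s} {s′} {i} {i′} eq) = trans (near-leaf-leaf s i s′ i′) (cong not eq)

RespectsLabel : ℤ → ℤ → Label → Set
RespectsLabel a b l = (∣ a - b ∣ ℕ.≤ 1 → l ≡ N) × (l ≡ N → ∣ a - b ∣ ℕ.≤ 1)

near⇒respectsLabel : ∀ a b l → near a b ≡ isNear l → RespectsLabel a b l
near⇒respectsLabel a b N eq = (λ _ → refl) , (λ _ → toWitness (subst T (sym eq) tt))
near⇒respectsLabel a b F eq = (λ close → ⊥-elim (subst T eq (fromWitness close))) , (λ ())

compatible⇒respectsLabel : ∀ {a b l} → Compatible a b l → RespectsLabel ⟦ a ⟧ ⟦ b ⟧ l
compatible⇒respectsLabel {a} {b} {l} c = near⇒respectsLabel ⟦ a ⟧ ⟦ b ⟧ l (compatible⇒near c)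

toℕ-window : ∀ {n} (i : Fin n) → (+ 0 ℤ.≤ + toℕ i) × (+ toℕ i + + 1 ℤ.≤ + 0 + + n)
toℕ-window {n} i = ℤ.+≤+ ℕ.z≤n , ℤ.+≤+ (subst (ℕ._≤ n) (ℕ.+-comm 1 (toℕ i)) (toℕ<n i))

record RoleAssignment (G : Graph) (L : E G → Label) : Set where
  field
    role       : V G → Role
    compatible : ∀ e → Compatible (role (src G e)) (role (tgt G e)) (L e)

labelWithin : (b b′ : Bool) → (T b → T b′ → Label) → Label
labelWithin true true k = k tt tt
labelWithin _    _    k = N

labelWithin-agrees : ∀ {b b′} k (p : T b) (q : T b′) → labelWithin b b′ k ≡ k p q
labelWithin-agrees {true} {true} k tt tt = refl

extend : (G : Graph) (S : V G → Bool) → EdgeLabeling G S → E G → Label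
extend G S l e = labelWithin (S (src G e)) (S (tgt G e)) (l e)

roleAssignments⇒colorable : (G : Graph) → ((L : E G → Label) → RoleAssignment G L) →
                            (S : V G → Bool) → TotalThresholdColorable G S 5 1
roleAssignments⇒colorable G assign S l =
  (λ v _ → ⟦ role v ⟧) ,
  (+ 0 , λ v _ → toℕ-window (colour (role v))) ,
  λ e su sv → subst (RespectsLabel ⟦ role (src G e) ⟧ ⟦ role (tgt G e) ⟧)
                    (labelWithin-agrees (l e) su sv)
                    (compatible⇒respectsLabel (compatible e))
  where open RoleAssignment (assign (extend G S l))

integrate : (ℤ → Bool) → ℤ → Bool
integrate δ (+ zero)     = false
integrate δ (+ suc n)    = integrate δ (+ n) xor δ (+ n)
integrate δ -[1+ zero ]  = δ -[1+ zero ]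
integrate δ -[1+ suc n ] = integrate δ -[1+ n ] xor δ -[1+ suc n ]

integrate-suc : ∀ δ y → integrate δ (y + + 1) ≡ integrate δ y xor δ y
integrate-suc δ (+ n)        = cong (integrate δ ∘ +_) (ℕ.+-comm n 1)
integrate-suc δ -[1+ zero ]  = sym (xor-same (δ -[1+ zero ]))
integrate-suc δ -[1+ suc n ] = sym (xor-cancelʳ (integrate δ -[1+ n ]) (δ -[1+ suc n ]))

integrate-pred : ∀ δ y → integrate δ y ≡ integrate δ (y - + 1) xor δ (y - + 1)
integrate-pred δ y = trans (cong (integrate δ) (sym (i-1+1≡i y))) (integrate-suc δ (y - + 1))

module TruncatedSquareRoles (L : OctEdge → Label) where
  farEdge nearEdge : OctEdge → Bool
  farEdge e  = isFar (L e)
  nearEdge e = isNear (L e)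

  -- The path through column x visits south, west, north of each square, then moves up.
  δ : ℤ → ℤ → Bool
  δ x y = (farEdge (sq x y west) xor farEdge (sq x y north)) xor farEdge (vl x y)

  P : ℤ → ℤ → Bool
  P x = integrate (δ x)

  role : ℤ × ℤ × Dir → Role
  role (x , y , east)  = hub
  role (x , y , south) = leaf (P x y) (nearEdge (sq x y south))
  role (x , y , west)  = leaf (P x y xor farEdge (sq x y west)) (nearEdge (hl (x - + 1) y))
  role (x , y , north) = leaf (P x y xor (farEdge (sq x y west) xor farEdge (sq x y north)))
                              (nearEdge (sq x y east))

  compatible : ∀ e → Compatible (role (octSrc e)) (role (octTgt e)) (L e)
  compatible (sq x y east)  = hub-leaf refl
  compatible (sq x y north) = compatible-sym (path-step (P x y) (farEdge (sq x y west)) refl)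
  compatible (sq x y west)  = compatible-sym (path-start (P x y) refl)
  compatible (sq x y south) = leaf-hub refl
  compatible (hl x y)       = hub-leaf (cong (λ z → nearEdge (hl z y)) (i+1-1≡i x))
  compatible (vl x y)       = path-step (P x y) (farEdge (sq x y west) xor farEdge (sq x y north))
                                        (integrate-suc (δ x) y)

  assignment : RoleAssignment TruncatedSquare L
  assignment = record { role = role ; compatible = compatible }

parity : ℤ → Bool
parity = integrate (λ _ → true)

-- halfParity y is the parity of ⌊y/2⌋.
halfParity : ℤ → Bool
halfParity = integrate parity

phase : ℤ → ℤ → Bool
phase x y = parity x xor halfParity y

phase-suc : ∀ x y → phase (x + + 1) y ≡ not (phase x y)
phase-suc x y = begin
  parity (x + + 1) xor halfParity y    ≡⟨ cong (_xor halfParity y) (integrate-suc _ x) ⟩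
  (parity x xor true) xor halfParity y ≡⟨ cong (_xor halfParity y) (xor-comm (parity x) true) ⟩
  not (parity x) xor halfParity y      ≡⟨ not-distribˡ-xor (parity x) (halfParity y) ⟨
  not (phase x y)                      ∎
  where open ≡-Reasoning

parity-pred : ∀ y → parity y ≡ not (parity (y - + 1))
parity-pred y = trans (integrate-pred _ y) (xor-comm (parity (y - + 1)) true)

phase-pred-pred : ∀ x y → phase x y ≡ not (phase x (y - + 1 - + 1))
phase-pred-pred x y = begin
  parity x xor halfParity y          ≡⟨ cong (parity x xor_) halfParity-flips ⟩
  parity x xor not (halfParity z)    ≡⟨ not-distribʳ-xor (parity x) (halfParity z) ⟨
  not (phase x z)                    ∎
  where
  open ≡-Reasoning
  z = y - + 1 - + 1
  halfParity-flips : halfParity y ≡ not (halfParity z)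
  halfParity-flips = begin
    halfParity y                                     ≡⟨ integrate-pred parity y ⟩
    halfParity (y - + 1) xor parity (y - + 1)        ≡⟨ cong₂ _xor_ (integrate-pred parity (y - + 1))
                                                                    (parity-pred (y - + 1)) ⟩
    (halfParity z xor parity z) xor not (parity z)   ≡⟨ not-distribʳ-xor (halfParity z xor parity z) (parity z) ⟨
    not ((halfParity z xor parity z) xor parity z)   ≡⟨ cong not (xor-cancelʳ (halfParity z) (parity z)) ⟩
    not (halfParity z)                               ∎

module HexagonalRoles (L : HexEdge → Label) where
  farEdge nearEdge : HexEdge → Bool
  farEdge e  = isFar (L e)
  nearEdge e = isNear (L e)

  -- Rows y₀ (lower) and y₁ = y₀ + 1 (upper) with y₀ even form a pair.  Column x of the
  -- pair has phase h = phase x y₀.  If h holds, A(x,y₀) and B(x,y₁) are hubs and the path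
  -- passes A(x,y₁), B(x,y₀); otherwise it passes A(x,y₀), B(x,y₀), A(x,y₁), B(x,y₁).
  -- Either way it then moves on to column x + 1 through an e₁ edge.
  module Pair (y₀ y₁ : ℤ) where
    cellStep : Bool → ℤ → Bool
    cellStep false x =
      ((farEdge (e₀ x y₀) xor farEdge (e₂ x y₁)) xor farEdge (e₀ x y₁)) xor farEdge (e₁ (x + + 1) y₁)
    cellStep true  x = farEdge (e₂ x y₁) xor farEdge (e₁ (x + + 1) y₀)

    P : ℤ → Bool
    P = integrate (λ x → cellStep (phase x y₀) x)

    P-suc : ∀ {h} x → phase x y₀ ≡ h → P (x + + 1) ≡ P x xor cellStep h x
    P-suc x refl = integrate-suc _ x

    lowerA lowerB upperA upperB : Bool → ℤ → Role
    lowerA false x = leaf (P x) (nearEdge (e₂ x y₀))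
    lowerA true  x = hub
    lowerB false x = leaf (P x xor farEdge (e₀ x y₀)) (nearEdge (e₁ (x + + 1) y₀))
    lowerB true  x = leaf (P x xor farEdge (e₂ x y₁)) (nearEdge (e₀ x y₀))
    upperA false x = leaf (P x xor (farEdge (e₀ x y₀) xor farEdge (e₂ x y₁))) (nearEdge (e₁ x y₁))
    upperA true  x = leaf (P x) (nearEdge (e₀ x y₁))
    upperB false x = leaf (P x xor ((farEdge (e₀ x y₀) xor farEdge (e₂ x y₁)) xor farEdge (e₀ x y₁)))
                          (nearEdge (e₂ x (y₁ + + 1)))
    upperB true  x = hub

    e₀-lower : ∀ h x → Compatible (lowerA h x) (lowerB h x) (L (e₀ x y₀))
    e₀-lower false x = path-start (P x) refl
    e₀-lower true  x = hub-leaf refl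

    e₀-upper : ∀ h x → Compatible (upperA h x) (upperB h x) (L (e₀ x y₁))
    e₀-upper false x = path-step (P x) (farEdge (e₀ x y₀) xor farEdge (e₂ x y₁)) refl
    e₀-upper true  x = leaf-hub refl

    rung : ∀ h x → Compatible (upperA h x) (lowerB h x) (L (e₂ x y₁))
    rung false x = compatible-sym (path-step (P x) (farEdge (e₀ x y₀)) refl)
    rung true  x = path-start (P x) refl

    e₁-lower : ∀ x → Compatible (lowerA (phase (x + + 1) y₀) (x + + 1)) (lowerB (phase x y₀) x)
                                (L (e₁ (x + + 1) y₀))
    e₁-lower x rewrite phase-suc x y₀ with phase x y₀ in eq
    ... | false = hub-leaf refl
    ... | true  = compatible-sym (path-step (P x) (farEdge (e₂ x y₁)) (P-suc x eq))

    e₁-upper : ∀ x → Compatible (upperA (phase (x + + 1) y₀) (x + + 1)) (upperB (phase x y₀) x)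
                                (L (e₁ (x + + 1) y₁))
    e₁-upper x rewrite phase-suc x y₀ with phase x y₀ in eq
    ... | false = compatible-sym (path-step (P x) ((farEdge (e₀ x y₀) xor farEdge (e₂ x y₁)) xor farEdge (e₀ x y₁))
                                            (P-suc x eq))
    ... | true  = leaf-hub refl

  open Pair

  rowA rowB : Bool → ℤ → ℤ → Role
  rowA false x y = lowerA y (y + + 1) (phase x y) x
  rowA true  x y = upperA (y - + 1) y (phase x (y - + 1)) x
  rowB false x y = lowerB y (y + + 1) (phase x y) x
  rowB true  x y = upperB (y - + 1) y (phase x (y - + 1)) x

  role : ℤ × ℤ × Bool → Role
  role (x , y , true)  = rowA (parity y) x y
  role (x , y , false) = rowB (parity y) x y

  e₀-row : ∀ p x y → Compatible (rowA p x y) (rowB p x y) (L (e₀ x y))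
  e₀-row false x y = e₀-lower y (y + + 1) (phase x y) x
  e₀-row true  x y = e₀-upper (y - + 1) y (phase x (y - + 1)) x

  e₁-row : ∀ p x y → Compatible (rowA p (x + + 1) y) (rowB p x y) (L (e₁ (x + + 1) y))
  e₁-row false x y = e₁-lower y (y + + 1) x
  e₁-row true  x y = e₁-upper (y - + 1) y x

  e₂-between-pairs : ∀ h x y → Compatible (lowerA y (y + + 1) (not h) x)
                                          (upperB (y - + 1 - + 1) (y - + 1) h x) (L (e₂ x y))
  e₂-between-pairs false x y = hub-leaf (cong (λ z → nearEdge (e₂ x z)) (i-1+1≡i y))
  e₂-between-pairs true  x y = leaf-hub refl

  e₂-rows : ∀ x y → Compatible (rowA (parity y) x y) (rowB (parity (y - + 1)) x (y - + 1)) (L (e₂ x y))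
  e₂-rows x y rewrite parity-pred y with parity (y - + 1)
  ... | false = subst (λ z → Compatible (upperA (y - + 1) y (phase x (y - + 1)) x)
                                        (lowerB (y - + 1) z (phase x (y - + 1)) x) (L (e₂ x y)))
                      (sym (i-1+1≡i y)) (rung (y - + 1) y (phase x (y - + 1)) x)
  ... | true  rewrite phase-pred-pred x y = e₂-between-pairs (phase x (y - + 1 - + 1)) x y

  compatible : ∀ e → Compatible (role (hexSrc e)) (role (hexTgt e)) (L e)
  compatible (e₀ x y) = e₀-row (parity y) x y
  compatible (e₁ x y) =
    subst (λ z → Compatible (rowA (parity y) z y) (rowB (parity y) (x - + 1) y) (L (e₁ z y)))
          (i-1+1≡i x) (e₁-row (parity y) (x - + 1) y)
  compatible (e₂ x y) = e₂-rows x y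

  assignment : RoleAssignment Hexagonal L
  assignment = record { role = role ; compatible = compatible }

mainTheorem2 : ((S : V Hexagonal → Bool) → TotalThresholdColorable Hexagonal S 5 1)
               × ((S : V TruncatedSquare → Bool) → TotalThresholdColorable TruncatedSquare S 5 1)
mainTheorem2 = roleAssignments⇒colorable Hexagonal HexagonalRoles.assignment
             , roleAssignments⇒colorable TruncatedSquare TruncatedSquareRoles.assignment
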